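{- Let $(X_1,I_1,Y_1)$ and $(X_2,I_2,Y_2)$ be polarities and $p:X_2\to X_1$, $q:Y_2\to Y_1$ maps. The following are equivalent: (1) for every decreasing subset $B\subseteq Y_1$, $\boxminus_2\,q^{ -1}(B)\subseteq p^{ -1}(\boxminus_1 B)$; (2) for every $y\in Y_1$, $\boxminus_2\,q^{ -1}(Y_1\setminus\Gamma y)\subseteq p^{ -1}(\boxminus_1(Y_1\setminus\Gamma y))$; (3) for all $x'\in X_2$ and $y\in Y_1$: if $p(x')I_1y$ then there exists $y'\in Y_2$ with $y\le q(y')$ and $x'I_2y'$.
   Context: A polarity is $(X,I,Y)$ with $X,Y$ nonempty, $I\subseteq X\times Y$; $x\perp y$ iff $(x,y)\notin I$; ${}^\perp V=\{x:x\perp y\ \forall y\in V\}$. Preorder on $Y$: $y\le v$ iff ${}^\perp\{y\}\subseteq{}^\perp\{v\}$; $\Gamma y=\{v\in Y:y\le v\}$; $B\subseteq Y$ is decreasing if $v\in B$ and $y\le v$ imply $y\in B$. For $V\subseteq Y$: $\boxminus V=\{x\in X:\forall y\in Y\,(xIy\Rightarrow y\in V)\}$ (subscript indicating the polarity). -}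

module Defs where

open import Level using (0ℓ)
open import Data.Product using (Σ; ∃; _×_; _,_)
open import Relation.Nullary using (¬_)
open import Relation.Unary using (Pred; _⊆_; _∈_; ∁; ｛_｝)

record Polarity : Set₁ where
  field
    X  : Set
    Y  : Set
    I  : X → Y → Set
    x₀ : X
    y₀ : Y

module _ (P : Polarity) where
  open Polarity P

  _⊥_ : X → Y → Set
  x ⊥ y = ¬ I x y

  ⊥[_] : Pred Y 0ℓ → Pred X 0ℓ
  ⊥[ V ] x = ∀ y → y ∈ V → x ⊥ y

  _≤_ : Y → Y → Set
  y ≤ v = ⊥[ ｛ y ｝ ] ⊆ ⊥[ ｛ v ｝ ]

  Γ : Y → Pred Y 0ℓ
  Γ y v = y ≤ v

  Decreasing : Pred Y 0ℓ → Set
  Decreasing B = ∀ {v y} → v ∈ B → y ≤ v → y ∈ B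

  ⊟ : Pred Y 0ℓ → Pred X 0ℓ
  ⊟ V x = ∀ y → I x y → y ∈ V

{-# OPTIONS --safe #-}
module Submission where

-- Condition (3) implies (1) outright: if p x' I₁ y, a witness y' with x' I₂ y' puts q y'
-- in B, and B is decreasing with y ≤ q y'. (1) implies (2) because the complement of
-- Γ y is decreasing. For (2) ⇒ (3), suppose no witness y' exists for x' and y; then
-- x' ∈ ⊟₂ q⁻¹(Y₁ ∖ Γ y), so by (2) every I₁-neighbour of p x' lies outside Γ y,
-- contradicting p x' I₁ y and y ≤ y. Only this step uses excluded middle.

open import Defs
open import Level using (0ℓ)
open import Axiom.ExcludedMiddle using (ExcludedMiddle)
open import Data.Product using (Σ; _×_; _,_)
open import Function.Bundles using (_⇔_; mk⇔)
open import Relation.Unary using (Pred; _⊆_; ∁)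
open import Function using (_∘_)
open import Relation.Nullary.Decidable using (decidable-stable)

module _ (P : Polarity) where

  ≤-refl : ∀ {y} → _≤_ P y y
  ≤-refl x⊥y = x⊥y

  ≤-trans : ∀ {y v w} → _≤_ P y v → _≤_ P v w → _≤_ P y w
  ≤-trans y≤v v≤w = v≤w ∘ y≤v

  ∁Γ-decreasing : ∀ y → Decreasing P (∁ (Γ P y))
  ∁Γ-decreasing y y≰v w≤v y≤w = y≰v (≤-trans y≤w w≤v)

module Conditions (P₁ P₂ : Polarity)
         (p : Polarity.X P₂ → Polarity.X P₁) (q : Polarity.Y P₂ → Polarity.Y P₁) where
  open Polarity

  ⊟-PreservedOnDecreasing : Set₁
  ⊟-PreservedOnDecreasing =
    ∀ (B : Pred (Y P₁) 0ℓ) → Decreasing P₁ B → ⊟ P₂ (B ∘ q) ⊆ (⊟ P₁ B ∘ p)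

  ⊟-PreservedOn∁Γ : Set
  ⊟-PreservedOn∁Γ =
    ∀ (y : Y P₁) → ⊟ P₂ (∁ (Γ P₁ y) ∘ q) ⊆ (⊟ P₁ (∁ (Γ P₁ y)) ∘ p)

  IncidenceLifts : Set
  IncidenceLifts =
    ∀ (x' : X P₂) (y : Y P₁) → I P₁ (p x') y → Σ (Y P₂) (λ y' → _≤_ P₁ y (q y') × I P₂ x' y')

  onDecreasing⇒on∁Γ : ⊟-PreservedOnDecreasing → ⊟-PreservedOn∁Γ
  onDecreasing⇒on∁Γ preserved y = preserved (∁ (Γ P₁ y)) (∁Γ-decreasing P₁ y)

  incidenceLifts⇒onDecreasing : IncidenceLifts → ⊟-PreservedOnDecreasing
  incidenceLifts⇒onDecreasing lifts B B-decreasing {x'} x'∈⊟ y px'Iy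
    with lifts x' y px'Iy
  ... | y' , y≤qy' , x'Iy' = B-decreasing (x'∈⊟ y' x'Iy') y≤qy'

  on∁Γ⇒incidenceLifts : ExcludedMiddle 0ℓ → ⊟-PreservedOn∁Γ → IncidenceLifts
  on∁Γ⇒incidenceLifts em preserved x' y px'Iy = decidable-stable em λ noWitness →
    preserved y (λ y' x'Iy' y≤qy' → noWitness (y' , (λ {x} → y≤qy' {x}) , x'Iy'))
              y px'Iy (≤-refl P₁)

lemma3p19 : ExcludedMiddle 0ℓ → (P₁ P₂ : Polarity)
    → (p : Polarity.X P₂ → Polarity.X P₁) → (q : Polarity.Y P₂ → Polarity.Y P₁)
    → ((∀ (B : Pred (Polarity.Y P₁) 0ℓ) → Decreasing P₁ B → ⊟ P₂ (B ∘ q) ⊆ (⊟ P₁ B ∘ p))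
        ⇔ (∀ (y : Polarity.Y P₁) → ⊟ P₂ (∁ (Γ P₁ y) ∘ q) ⊆ (⊟ P₁ (∁ (Γ P₁ y)) ∘ p)))
      × ((∀ (y : Polarity.Y P₁) → ⊟ P₂ (∁ (Γ P₁ y) ∘ q) ⊆ (⊟ P₁ (∁ (Γ P₁ y)) ∘ p))
        ⇔ (∀ (x' : Polarity.X P₂) (y : Polarity.Y P₁) → Polarity.I P₁ (p x') y
            → Σ (Polarity.Y P₂) (λ y' → _≤_ P₁ y (q y') × Polarity.I P₂ x' y')))
lemma3p19 em P₁ P₂ p q =
  mk⇔ onDecreasing⇒on∁Γ (incidenceLifts⇒onDecreasing ∘ on∁Γ⇒incidenceLifts em) ,
  mk⇔ (on∁Γ⇒incidenceLifts em) (onDecreasing⇒on∁Γ ∘ incidenceLifts⇒onDecreasing)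
  where open Conditions P₁ P₂ p q
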